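{- Let $G_1$ and $G_2$ be disjoint finite simple graphs. Then $\nu(G_1\oplus G_2)=\nu(G_1)+\nu(G_2)+pr(\rho(G_1)\rho(G_2))$.
   Context: For a finite simple graph $G$ with $V(G)=\{v_1,\dots,v_n\}$, the closed neighborhood matrix $N(G)$ is the $n\times n$ matrix over $\mathbb{Z}_2$ whose $i$-th column is the characteristic vector of $N[v_i]=\{w : w \text{ adjacent to } v_i \text{ or } w=v_i\}$. The rank $\rho(G)$ and nullity $\nu(G)$ are the dimensions over $\mathbb{Z}_2$ of the column space and kernel of $N(G)$. For an integer $a$, $pr(a)$ is $0$ if $a$ is even and $1$ if $a$ is odd. The join $G_1\oplus G_2$ of disjoint graphs has vertex set $V(G_1)\cup V(G_2)$ and edge set $E(G_1)\cup E(G_2)\cup\{uv : u\in V(G_1), v\in V(G_2)\}$. -}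

module Defs where

open import Data.Nat using (ℕ; zero; suc; _+_; _*_; _%_)
open import Data.Bool using (Bool; true; false; _∧_; _∨_; _xor_; not)
open import Data.Fin using (Fin; zero; suc; splitAt)
open import Data.Sum using (_⊎_; inj₁; inj₂)
open import Data.Product using (Σ; _×_; _,_; ∃)
open import Relation.Binary.PropositionalEquality using (_≡_; refl)

-- Z₂ is represented by Bool (false = 0, true = 1, xor = +, ∧ = ·).

record Graph : Set where
  field
    order : ℕ
    adj   : Fin order → Fin order → Bool
    sym   : ∀ i j → adj i j ≡ adj j i
    irrefl : ∀ i → adj i i ≡ false
open Graph public

Vec₂ : ℕ → Set
Vec₂ n = Fin n → Bool

zeroV : ∀ {n} → Vec₂ n
zeroV _ = false

sumZ₂ : ∀ {k} → (Fin k → Bool) → Bool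
sumZ₂ {zero}  f = false
sumZ₂ {suc k} f = f zero xor sumZ₂ (λ i → f (suc i))

lincomb : ∀ {n k} → (Fin k → Vec₂ n) → (Fin k → Bool) → Vec₂ n
lincomb b c x = sumZ₂ (λ i → c i ∧ b i x)

eqFin : ∀ {n} → Fin n → Fin n → Bool
eqFin zero    zero    = true
eqFin zero    (suc _) = false
eqFin (suc _) zero    = false
eqFin (suc i) (suc j) = eqFin i j

N : (G : Graph) → Fin (order G) → Fin (order G) → Bool
N G w v = adj G w v ∨ eqFin w v

_·_ : ∀ {m n} → (Fin m → Fin n → Bool) → Vec₂ n → Vec₂ m
(M · x) r = sumZ₂ (λ c → M r c ∧ x c)

HasDim : ∀ {n} → (Vec₂ n → Set) → ℕ → Set
HasDim {n} S d =
  Σ (Fin d → Vec₂ n) λ b →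
    (∀ i → S (b i)) ×
    (∀ c → (∀ x → lincomb b c x ≡ false) → ∀ i → c i ≡ false) ×
    (∀ v → S v → Σ (Fin d → Bool) λ c → ∀ x → lincomb b c x ≡ v x)

ColSpace : ∀ {n} → (Fin n → Fin n → Bool) → Vec₂ n → Set
ColSpace M v = Σ _ λ x → ∀ r → (M · x) r ≡ v r

Kernel : ∀ {n} → (Fin n → Fin n → Bool) → Vec₂ n → Set
Kernel M x = ∀ r → (M · x) r ≡ false

Rank : Graph → ℕ → Set
Rank G ρ = HasDim (ColSpace (N G)) ρ

Nullity : Graph → ℕ → Set
Nullity G ν = HasDim (Kernel (N G)) ν

pr : ℕ → ℕ
pr a = a % 2

-- join G₁ ⊕ G₂ on vertex set Fin (n₁ + n₂): first n₁ vertices are G₁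
joinAdj : (G₁ G₂ : Graph) → Fin (order G₁ + order G₂) → Fin (order G₁ + order G₂) → Bool
joinAdj G₁ G₂ i j with splitAt (order G₁) i | splitAt (order G₁) j
... | inj₁ a | inj₁ b = adj G₁ a b
... | inj₂ a | inj₂ b = adj G₂ a b
... | inj₁ _ | inj₂ _ = true
... | inj₂ _ | inj₁ _ = true

joinSym : (G₁ G₂ : Graph) → ∀ i j → joinAdj G₁ G₂ i j ≡ joinAdj G₁ G₂ j i
joinSym G₁ G₂ i j with splitAt (order G₁) i | splitAt (order G₁) j
... | inj₁ a | inj₁ b = sym G₁ a b
... | inj₂ a | inj₂ b = sym G₂ a b
... | inj₁ _ | inj₂ _ = refl
... | inj₂ _ | inj₁ _ = refl

joinIrrefl : (G₁ G₂ : Graph) → ∀ i → joinAdj G₁ G₂ i i ≡ false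
joinIrrefl G₁ G₂ i with splitAt (order G₁) i
... | inj₁ a = irrefl G₁ a
... | inj₂ a = irrefl G₂ a

_⊕_ : Graph → Graph → Graph
G₁ ⊕ G₂ = record
  { order = order G₁ + order G₂
  ; adj = joinAdj G₁ G₂
  ; sym = joinSym G₁ G₂
  ; irrefl = joinIrrefl G₁ G₂ }

{-# OPTIONS --safe #-}
module Submission where

-- Write a vector of Z₂^(n₁+n₂) as (x , y). As N(G₁ ⊕ G₂) has all-ones off-diagonal
-- blocks, (x , y) is in its kernel iff N(G₁) x = (Σ y)·1 and N(G₂) y = (Σ x)·1.
-- For a symmetric Z₂-matrix M with unit diagonal the quadratic form x·Mx equals Σ x.
-- So kernel vectors have even weight, 1 (being orthogonal to the kernel) lies in
-- the column space, and Mx = 1 forces Σ x ≡ rank M (mod 2), the trace of the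
-- identity on the column space computed with a dual basis. Therefore the kernel of
-- the join is ker N(G₁) × ker N(G₂), enlarged by one vector (z₁ , z₂) with
-- N(Gᵢ) zᵢ = 1 exactly when both ranks are odd.

open import Defs hiding (sym)

open import Algebra.Bundles using (CommutativeMonoid; CommutativeRing)
open import Data.Bool using (Bool; true; false; not; _∧_; _∨_; _xor_; if_then_else_)
open import Data.Bool.Properties
  using (∧-comm; ∧-assoc; ∧-idem; ∧-zeroʳ; ∧-identityʳ; xor-comm; xor-assoc; xor-same;
         xor-identityʳ; ∧-distribˡ-xor; ∧-distribʳ-xor; not-involutive;
         ∧-commutativeMonoid; xor-∧-commutativeRing)
open import Data.Fin using (Fin; zero; suc; punchIn; _↑ˡ_; _↑ʳ_)
open import Data.Fin.Properties using (splitAt-↑ˡ; splitAt-↑ʳ)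
open import Data.Nat using (ℕ; zero; suc; _+_; _*_; _≤_; _<_; s≤s; _%_)
open import Data.Nat.DivMod using ([m+n]%n≡m%n; %-distribˡ-*)
open import Data.Nat.Properties using (≤-antisym; ≮⇒≥; m<n⇒m<1+n; +-comm; +-identityʳ)
open import Data.Product using (∃; _×_; _,_; proj₁; proj₂)
open import Data.Sum using (_⊎_; inj₁; inj₂)
open import Data.Vec.Functional using (_∷_; _++_; insertAt; removeAt)
open import Data.Vec.Functional.Properties
  using (lookup-++ˡ; lookup-++ʳ; insertAt-lookup; insertAt-punchIn)
open import Function using (_∘_)
open import Relation.Binary.Definitions using (_Respects_)
open import Relation.Binary.PropositionalEquality
  using (_≡_; refl; sym; trans; cong; cong₂; cong-app; subst; _≗_; module ≡-Reasoning)
open import Relation.Nullary using (contradiction)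
open import Relation.Unary using (_⊆_; _≐_)

open import Algebra.Properties.CommutativeSemigroup
  (CommutativeMonoid.commutativeSemigroup ∧-commutativeMonoid)
  using (x∙yz≈yx∙z; x∙yz≈z∙yx)
open import Algebra.Properties.Semiring.Sum (CommutativeRing.semiring xor-∧-commutativeRing)
  using (sum; sum-cong-≗; sum-replicate-zero; ∑-distrib-+; ∑-comm; sum-remove;
         *-distribˡ-sum; *-distribʳ-sum)

open ≡-Reasoning

xor-cancelˡ : ∀ a b → a xor (a xor b) ≡ b
xor-cancelˡ a b = trans (sym (xor-assoc a a b)) (cong (_xor b) (xor-same a))

xor≡false⇒≡ : ∀ {a b} → a xor b ≡ false → a ≡ b
xor≡false⇒≡ {a} {b} a+b≡0 = begin
  a                   ≡⟨ sym (xor-identityʳ a) ⟩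
  a xor false         ≡⟨ cong (a xor_) a+b≡0 ⟨
  a xor (a xor b)     ≡⟨ xor-cancelˡ a b ⟩
  b                   ∎

xor-cancel-middle : ∀ a b c → (a xor b) xor (b xor c) ≡ a xor c
xor-cancel-middle a b c = trans (xor-assoc a b (b xor c)) (cong (a xor_) (xor-cancelˡ b c))

∧-mutual-cases : ∀ {a b p q} → a ≡ b ∧ p → b ≡ a ∧ q →
                 (a ≡ false × b ≡ false) ⊎ (a ≡ true × b ≡ true × p ≡ true × q ≡ true)
∧-mutual-cases {b = false}            refl refl = inj₁ (refl , refl)
∧-mutual-cases {b = true} {p = true}  refl q≡1  = inj₂ (refl , refl , refl , sym q≡1)
∧-mutual-cases {b = true} {p = false} refl ()

odd : ℕ → Bool
odd zero    = false
odd (suc n) = not (odd n)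

pr≡odd : ∀ n → pr n ≡ (if odd n then 1 else 0)
pr≡odd zero          = refl
pr≡odd (suc zero)    = refl
pr≡odd (suc (suc n)) = begin
  (2 + n) % 2                      ≡⟨ cong (_% 2) (+-comm 2 n) ⟩
  (n + 2) % 2                      ≡⟨ [m+n]%n≡m%n n 2 ⟩
  n % 2                            ≡⟨ pr≡odd n ⟩
  (if odd n then 1 else 0)         ≡⟨ cong (if_then 1 else 0) (not-involutive (odd n)) ⟨
  (if not (not (odd n)) then 1 else 0) ∎

pr-* : ∀ m n → pr (m * n) ≡ (if odd m ∧ odd n then 1 else 0)
pr-* m n = begin
  (m * n) % 2                 ≡⟨ %-distribˡ-* m n 2 ⟩
  ((m % 2) * (n % 2)) % 2     ≡⟨ cong₂ (λ a b → (a * b) % 2) (pr≡odd m) (pr≡odd n) ⟩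
  (bit (odd m) * bit (odd n)) % 2 ≡⟨ bit-∧ (odd m) (odd n) ⟩
  bit (odd m ∧ odd n)         ∎
  where
  bit : Bool → ℕ
  bit b = if b then 1 else 0
  bit-∧ : ∀ a b → (bit a * bit b) % 2 ≡ bit (a ∧ b)
  bit-∧ true  true  = refl
  bit-∧ true  false = refl
  bit-∧ false _     = refl

sumZ₂≡sum : ∀ {k} (f : Fin k → Bool) → sumZ₂ f ≡ sum f
sumZ₂≡sum {zero}  f = refl
sumZ₂≡sum {suc k} f = cong (f zero xor_) (sumZ₂≡sum (f ∘ suc))

sumZ₂-cong : ∀ {k} {f g : Fin k → Bool} → f ≗ g → sumZ₂ f ≡ sumZ₂ g
sumZ₂-cong {f = f} {g} f≗g =
  trans (sumZ₂≡sum f) (trans (sum-cong-≗ f≗g) (sym (sumZ₂≡sum g)))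

sumZ₂-zero : ∀ k → sumZ₂ {k} (λ _ → false) ≡ false
sumZ₂-zero k = trans (sumZ₂≡sum {k} (λ _ → false)) (sum-replicate-zero k)

sumZ₂-true : ∀ k → sumZ₂ {k} (λ _ → true) ≡ odd k
sumZ₂-true zero    = refl
sumZ₂-true (suc k) = cong not (sumZ₂-true k)

sumZ₂-xor : ∀ {k} (f g : Fin k → Bool) →
            sumZ₂ (λ i → f i xor g i) ≡ sumZ₂ f xor sumZ₂ g
sumZ₂-xor f g = trans (sumZ₂≡sum (λ i → f i xor g i))
  (trans (∑-distrib-+ f g) (sym (cong₂ _xor_ (sumZ₂≡sum f) (sumZ₂≡sum g))))

sumZ₂-∧ˡ : ∀ {k} a (f : Fin k → Bool) → sumZ₂ (λ i → a ∧ f i) ≡ a ∧ sumZ₂ f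
sumZ₂-∧ˡ a f =
  trans (sumZ₂≡sum (λ i → a ∧ f i)) (sym (trans (cong (a ∧_) (sumZ₂≡sum f)) (*-distribˡ-sum a f)))

sumZ₂-∧ʳ : ∀ {k} a (f : Fin k → Bool) → sumZ₂ (λ i → f i ∧ a) ≡ sumZ₂ f ∧ a
sumZ₂-∧ʳ a f =
  trans (sumZ₂≡sum (λ i → f i ∧ a)) (sym (trans (cong (_∧ a) (sumZ₂≡sum f)) (*-distribʳ-sum a f)))

sumZ₂-comm : ∀ {k l} (f : Fin k → Fin l → Bool) →
             sumZ₂ (λ i → sumZ₂ (f i)) ≡ sumZ₂ (λ j → sumZ₂ (λ i → f i j))
sumZ₂-comm f = trans (double f) (trans (∑-comm f) (sym (double (λ j i → f i j))))
  where
  double : ∀ {k l} (g : Fin k → Fin l → Bool) →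
           sumZ₂ (λ i → sumZ₂ (g i)) ≡ sum (λ i → sum (g i))
  double g = trans (sumZ₂-cong (λ i → sumZ₂≡sum (g i))) (sumZ₂≡sum (λ i → sum (g i)))

sumZ₂-remove : ∀ {k} (p : Fin (suc k)) (f : Fin (suc k) → Bool) →
               sumZ₂ f ≡ f p xor sumZ₂ (removeAt f p)
sumZ₂-remove p f =
  trans (sumZ₂≡sum f)
        (trans (sum-remove {i = p} f) (cong (f p xor_) (sym (sumZ₂≡sum (removeAt f p)))))

sumZ₂-↑ : ∀ m {n} (f : Fin (m + n) → Bool) →
          sumZ₂ f ≡ sumZ₂ (f ∘ (_↑ˡ n)) xor sumZ₂ (f ∘ (m ↑ʳ_))
sumZ₂-↑ zero    f = refl
sumZ₂-↑ (suc m) f =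
  trans (cong (f zero xor_) (sumZ₂-↑ m (f ∘ suc))) (sym (xor-assoc (f zero) _ _))

eqFin-refl : ∀ {k} (i : Fin k) → eqFin i i ≡ true
eqFin-refl zero    = refl
eqFin-refl (suc i) = eqFin-refl i

eqFin-sym : ∀ {k} (i j : Fin k) → eqFin i j ≡ eqFin j i
eqFin-sym zero    zero    = refl
eqFin-sym zero    (suc j) = refl
eqFin-sym (suc i) zero    = refl
eqFin-sym (suc i) (suc j) = eqFin-sym i j

eqFin-↑ˡ : ∀ {m} n (i j : Fin m) → eqFin (i ↑ˡ n) (j ↑ˡ n) ≡ eqFin i j
eqFin-↑ˡ n zero    zero    = refl
eqFin-↑ˡ n zero    (suc j) = refl
eqFin-↑ˡ n (suc i) zero    = refl
eqFin-↑ˡ n (suc i) (suc j) = eqFin-↑ˡ n i j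

eqFin-↑ʳ : ∀ {n} m (i j : Fin n) → eqFin (m ↑ʳ i) (m ↑ʳ j) ≡ eqFin i j
eqFin-↑ʳ zero    i j = refl
eqFin-↑ʳ (suc m) i j = eqFin-↑ʳ m i j

sumZ₂-δ : ∀ {k} (j : Fin k) (f : Fin k → Bool) → sumZ₂ (λ i → eqFin i j ∧ f i) ≡ f j
sumZ₂-δ {suc k} zero    f = trans (cong (f zero xor_) (sumZ₂-zero k)) (xor-identityʳ (f zero))
sumZ₂-δ         (suc j) f = sumZ₂-δ j (f ∘ suc)

sumZ₂-symmetric : ∀ {k} (f : Fin k → Fin k → Bool) → (∀ i j → f i j ≡ f j i) →
                  sumZ₂ (λ i → sumZ₂ (f i)) ≡ sumZ₂ (λ i → f i i)
sumZ₂-symmetric {zero}  f f-sym = refl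
sumZ₂-symmetric {suc k} f f-sym = begin
  (f₀₀ xor row) xor sumZ₂ (λ i → f (suc i) zero xor sumZ₂ (λ j → f (suc i) (suc j)))
    ≡⟨ cong ((f₀₀ xor row) xor_)
            (sumZ₂-xor (λ i → f (suc i) zero) (λ i → sumZ₂ (λ j → f (suc i) (suc j)))) ⟩
  (f₀₀ xor row) xor (sumZ₂ (λ i → f (suc i) zero) xor sumZ₂ (λ i → sumZ₂ (λ j → f (suc i) (suc j))))
    ≡⟨ cong₂ (λ c d → (f₀₀ xor row) xor (c xor d))
             (sumZ₂-cong (λ i → f-sym (suc i) zero))
             (sumZ₂-symmetric (λ i j → f (suc i) (suc j)) (λ i j → f-sym (suc i) (suc j))) ⟩
  (f₀₀ xor row) xor (row xor sumZ₂ (λ i → f (suc i) (suc i)))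
    ≡⟨ xor-cancel-middle f₀₀ row _ ⟩
  f₀₀ xor sumZ₂ (λ i → f (suc i) (suc i)) ∎
  where
  f₀₀ row : Bool
  f₀₀ = f zero zero
  row = sumZ₂ (λ j → f zero (suc j))

↑-elim : ∀ m {n} {P : Fin (m + n) → Set} →
         (∀ i → P (i ↑ˡ n)) → (∀ j → P (m ↑ʳ j)) → ∀ t → P t
↑-elim zero    P-↑ˡ P-↑ʳ t       = P-↑ʳ t
↑-elim (suc m) P-↑ˡ P-↑ʳ zero    = P-↑ˡ zero
↑-elim (suc m) P-↑ˡ P-↑ʳ (suc t) = ↑-elim m (P-↑ˡ ∘ suc) P-↑ʳ t

infixl 6 _+ᵥ_
infixr 7 _*ᵥ_
infix 25 _ᵀ

_+ᵥ_ : ∀ {n} → Vec₂ n → Vec₂ n → Vec₂ n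
(u +ᵥ v) i = u i xor v i

_*ᵥ_ : ∀ {n} → Bool → Vec₂ n → Vec₂ n
(a *ᵥ v) i = a ∧ v i

ones : ∀ {n} → Vec₂ n
ones _ = true

_ᵀ : ∀ {m n} → (Fin m → Fin n → Bool) → Fin n → Fin m → Bool
(M ᵀ) i j = M j i

dot : ∀ {n} → Vec₂ n → Vec₂ n → Bool
dot u v = sumZ₂ (λ i → u i ∧ v i)

all-false-or-some-true : ∀ {n} (v : Vec₂ n) → v ≗ zeroV ⊎ ∃ λ r → v r ≡ true
all-false-or-some-true {zero}  v = inj₁ λ ()
all-false-or-some-true {suc n} v with v zero in v₀ | all-false-or-some-true (v ∘ suc)
... | true  | _              = inj₂ (zero , v₀)
... | false | inj₁ tail≗0    = inj₁ λ { zero → v₀ ; (suc r) → tail≗0 r }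
... | false | inj₂ (r , vᵣ) = inj₂ (suc r , vᵣ)

dot-comm : ∀ {n} (u v : Vec₂ n) → dot u v ≡ dot v u
dot-comm u v = sumZ₂-cong (λ i → ∧-comm (u i) (v i))

dot-congˡ : ∀ {n} {u u′ v : Vec₂ n} → u ≗ u′ → dot u v ≡ dot u′ v
dot-congˡ {v = v} u≗u′ = sumZ₂-cong (λ i → cong (_∧ v i) (u≗u′ i))

dot-congʳ : ∀ {n} {u v v′ : Vec₂ n} → v ≗ v′ → dot u v ≡ dot u v′
dot-congʳ {u = u} v≗v′ = sumZ₂-cong (λ i → cong (u i ∧_) (v≗v′ i))

dot-zeroˡ : ∀ {n} {u v : Vec₂ n} → u ≗ zeroV → dot u v ≡ false
dot-zeroˡ {n} u≗0 = trans (dot-congˡ u≗0) (sumZ₂-zero n)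

dot-zeroʳ : ∀ {n} {u v : Vec₂ n} → v ≗ zeroV → dot u v ≡ false
dot-zeroʳ {u = u} {v} v≗0 = trans (dot-comm u v) (dot-zeroˡ v≗0)

dot-+ᵥˡ : ∀ {n} (u v w : Vec₂ n) → dot (u +ᵥ v) w ≡ dot u w xor dot v w
dot-+ᵥˡ u v w = trans (sumZ₂-cong (λ i → ∧-distribʳ-xor (w i) (u i) (v i)))
                      (sumZ₂-xor (λ i → u i ∧ w i) (λ i → v i ∧ w i))

dot-+ᵥʳ : ∀ {n} (u v w : Vec₂ n) → dot u (v +ᵥ w) ≡ dot u v xor dot u w
dot-+ᵥʳ u v w = trans (sumZ₂-cong (λ i → ∧-distribˡ-xor (u i) (v i) (w i)))
                      (sumZ₂-xor (λ i → u i ∧ v i) (λ i → u i ∧ w i))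

dot-*ᵥˡ : ∀ {n} a (u v : Vec₂ n) → dot (a *ᵥ u) v ≡ a ∧ dot u v
dot-*ᵥˡ a u v = trans (sumZ₂-cong (λ i → ∧-assoc a (u i) (v i))) (sumZ₂-∧ˡ a (λ i → u i ∧ v i))

dot-++ʳ : ∀ {m n} (u : Vec₂ (m + n)) (p : Vec₂ m) (q : Vec₂ n) →
          dot u (p ++ q) ≡ dot (u ∘ (_↑ˡ n)) p xor dot (u ∘ (m ↑ʳ_)) q
dot-++ʳ {m} {n} u p q = trans (sumZ₂-↑ m (λ t → u t ∧ (p ++ q) t))
  (cong₂ _xor_ (dot-congʳ (lookup-++ˡ p q)) (dot-congʳ (lookup-++ʳ p q)))

dot-insertAt : ∀ {k} (u : Vec₂ (suc k)) (c : Vec₂ k) p s →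
               dot u (insertAt c p s) ≡ (u p ∧ s) xor dot (removeAt u p) c
dot-insertAt u c p s = trans (sumZ₂-remove p (λ i → u i ∧ insertAt c p s i))
  (cong₂ (λ a b → (u p ∧ a) xor b) (insertAt-lookup c p s) (dot-congʳ (insertAt-punchIn c p s)))

·-adjoint : ∀ {m n} (u : Vec₂ m) (M : Fin m → Fin n → Bool) (v : Vec₂ n) →
            dot u (M · v) ≡ dot (M ᵀ · u) v
·-adjoint u M v = begin
  sumZ₂ (λ r → u r ∧ sumZ₂ (λ c → M r c ∧ v c))
    ≡⟨ sumZ₂-cong (λ r → sumZ₂-∧ˡ (u r) (λ c → M r c ∧ v c)) ⟨
  sumZ₂ (λ r → sumZ₂ (λ c → u r ∧ (M r c ∧ v c)))
    ≡⟨ sumZ₂-comm (λ r c → u r ∧ (M r c ∧ v c)) ⟩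
  sumZ₂ (λ c → sumZ₂ (λ r → u r ∧ (M r c ∧ v c)))
    ≡⟨ sumZ₂-cong (λ c → sumZ₂-cong (λ r → x∙yz≈yx∙z (u r) (M r c) (v c))) ⟩
  sumZ₂ (λ c → sumZ₂ (λ r → (M r c ∧ u r) ∧ v c))
    ≡⟨ sumZ₂-cong (λ c → sumZ₂-∧ʳ (v c) (λ r → M r c ∧ u r)) ⟩
  sumZ₂ (λ c → sumZ₂ (λ r → M r c ∧ u r) ∧ v c) ∎

·-cong : ∀ {m n} (M : Fin m → Fin n → Bool) {x y : Vec₂ n} → x ≗ y → (M · x) ≗ (M · y)
·-cong M x≗y r = dot-congʳ x≗y

·-+ᵥ : ∀ {m n} (M : Fin m → Fin n → Bool) (x y : Vec₂ n) → (M · (x +ᵥ y)) ≗ (M · x) +ᵥ (M · y)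
·-+ᵥ M x y r = dot-+ᵥʳ (M r) x y

Kernel-resp : ∀ {n} {M : Fin n → Fin n → Bool} → Kernel M Respects _≗_
Kernel-resp {M = M} x≗y Mx≗0 r = trans (sym (·-cong M x≗y r)) (Mx≗0 r)

Kernel-zero : ∀ {n} {M : Fin n → Fin n → Bool} → Kernel M zeroV
Kernel-zero {M = M} r = dot-zeroʳ {u = M r} (λ _ → refl)

lincomb-ᵀ : ∀ {n k} (b : Fin k → Vec₂ n) (c : Vec₂ k) → lincomb b c ≗ (b ᵀ · c)
lincomb-ᵀ b c x = dot-comm c (λ i → b i x)

dot-lincomb : ∀ {n k} (u : Vec₂ n) (b : Fin k → Vec₂ n) (c : Vec₂ k) →
              dot u (lincomb b c) ≡ dot (b · u) c
dot-lincomb u b c = trans (dot-congʳ (lincomb-ᵀ b c)) (·-adjoint u (b ᵀ) c)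

lincomb-lincomb : ∀ {n m k} (w : Fin m → Vec₂ n) (α : Fin k → Vec₂ m) (c : Vec₂ k) →
                  lincomb (λ i → lincomb w (α i)) c ≗ lincomb w (α ᵀ · c)
lincomb-lincomb w α c x = ·-adjoint c α (λ l → w l x)

Independent : ∀ {n k} → (Fin k → Vec₂ n) → Set
Independent b = ∀ c → lincomb b c ≗ zeroV → ∀ i → c i ≡ false

InSpan : ∀ {n k} → (Fin k → Vec₂ n) → Vec₂ n → Set
InSpan b v = ∃ λ c → lincomb b c ≗ v

eliminate : ∀ {m k} → (Fin (suc m) → Fin (suc k) → Bool) → Fin (suc k) → Fin m → Fin k → Bool
eliminate A p r = removeAt (A (suc r)) p +ᵥ A (suc r) p *ᵥ removeAt (A zero) p

pivot-step : ∀ {m k} (A : Fin (suc m) → Fin (suc k) → Bool) (p : Fin (suc k)) → A zero p ≡ true →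
             ∀ c → (eliminate A p · c) ≗ zeroV →
             (A · insertAt c p (dot (removeAt (A zero) p) c)) ≗ zeroV
pivot-step A p A₀ₚ≡1 c _ zero = begin
  dot (A zero) (insertAt c p s) ≡⟨ dot-insertAt (A zero) c p s ⟩
  (A zero p ∧ s) xor s          ≡⟨ cong (λ a → (a ∧ s) xor s) A₀ₚ≡1 ⟩
  s xor s                       ≡⟨ xor-same s ⟩
  false                         ∎
  where
  s : Bool
  s = dot (removeAt (A zero) p) c
pivot-step A p _ c Ec≗0 (suc r) = begin
  dot (A (suc r)) (insertAt c p s)        ≡⟨ dot-insertAt (A (suc r)) c p s ⟩
  (a ∧ s) xor t                           ≡⟨ xor-comm (a ∧ s) t ⟩
  t xor (a ∧ s)                           ≡⟨ cong (t xor_) (dot-*ᵥˡ a (removeAt (A zero) p) c) ⟨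
  t xor dot (a *ᵥ removeAt (A zero) p) c  ≡⟨ dot-+ᵥˡ (removeAt (A (suc r)) p) _ c ⟨
  dot (eliminate A p r) c                 ≡⟨ Ec≗0 r ⟩
  false                                   ∎
  where
  s a t : Bool
  s = dot (removeAt (A zero) p) c
  a = A (suc r) p
  t = dot (removeAt (A (suc r)) p) c

nontrivial-kernel : ∀ {m k} (A : Fin m → Fin k → Bool) → m < k →
                    ∃ λ c → (A · c) ≗ zeroV × ∃ λ i → c i ≡ true
nontrivial-kernel {zero}  {suc k} A _ = ones , (λ ()) , zero , refl
nontrivial-kernel {suc m} {suc k} A (s≤s m<k) with all-false-or-some-true (A zero)
... | inj₁ A₀≗0 =
  let c , A′c≗0 , nonzero = nontrivial-kernel (A ∘ suc) (m<n⇒m<1+n m<k)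
  in  c , (λ { zero → dot-zeroˡ {v = c} A₀≗0 ; (suc r) → A′c≗0 r }) , nonzero
... | inj₂ (p , A₀ₚ≡1) =
  let c , Ec≗0 , i , cᵢ≡1 = nontrivial-kernel (eliminate A p) m<k
  in  insertAt c p _ , pivot-step A p A₀ₚ≡1 c Ec≗0 ,
      punchIn p i , trans (insertAt-punchIn c p _ i) cᵢ≡1

dependent-if-more : ∀ {n m k} {b : Fin k → Vec₂ n} (w : Fin m → Vec₂ n) →
                    (∀ i → InSpan w (b i)) → m < k →
                    ∃ λ c → lincomb b c ≗ zeroV × ∃ λ i → c i ≡ true
dependent-if-more {m = m} {k} {b} w b∈span m<k =
  let c , αᵀc≗0 , nonzero = nontrivial-kernel (α ᵀ) m<k
  in  c , bc≗0 c αᵀc≗0 , nonzero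
  where
  α : Fin k → Vec₂ m
  α i = proj₁ (b∈span i)
  bc≗0 : ∀ c → (α ᵀ · c) ≗ zeroV → lincomb b c ≗ zeroV
  bc≗0 c αᵀc≗0 x = begin
    lincomb b c x                        ≡⟨ dot-congʳ (λ i → proj₂ (b∈span i) x) ⟨
    lincomb (λ i → lincomb w (α i)) c x  ≡⟨ lincomb-lincomb w α c x ⟩
    lincomb w (α ᵀ · c) x                ≡⟨ dot-zeroˡ αᵀc≗0 ⟩
    false                                ∎

independent⇒≤ : ∀ {n m k} {b : Fin k → Vec₂ n} (w : Fin m → Vec₂ n) →
                Independent b → (∀ i → InSpan w (b i)) → k ≤ m
independent⇒≤ w b-ind b∈span = ≮⇒≥ λ m<k →
  let c , bc≗0 , i , cᵢ≡1 = dependent-if-more w b∈span m<k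
  in  contradiction (trans (sym cᵢ≡1) (b-ind c bc≗0 i)) λ ()

HasDim-unique : ∀ {n} {S : Vec₂ n → Set} {d d′} → HasDim S d → HasDim S d′ → d ≡ d′
HasDim-unique h h′ = ≤-antisym (HasDim-≤ h h′) (HasDim-≤ h′ h)
  where
  HasDim-≤ : ∀ {n} {S : Vec₂ n → Set} {d d′} → HasDim S d → HasDim S d′ → d ≤ d′
  HasDim-≤ (b , b∈S , b-ind , _) (b′ , _ , _ , b′-span) =
    independent⇒≤ b′ b-ind (λ i → b′-span (b i) (b∈S i))

span-or-separated : ∀ {n} k (u : Fin k → Vec₂ n) (v : Vec₂ n) →
                    InSpan u v ⊎ ∃ λ y → (∀ i → dot y (u i) ≡ false) × dot y v ≡ true
span-or-separated zero u v with all-false-or-some-true v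
... | inj₁ v≗0       = inj₁ ((λ ()) , λ x → sym (v≗0 x))
... | inj₂ (r , vᵣ≡1) = inj₂ ((λ i → eqFin i r) , (λ ()) , trans (sumZ₂-δ r v) vᵣ≡1)
span-or-separated {n} (suc k) u v with span-or-separated k (u ∘ suc) v
... | inj₁ (c , c≗v) = inj₁ (false ∷ c , c≗v)
... | inj₂ (y , y⊥ , y·v≡1) with dot y (u zero) in y·u₀
...   | false = inj₂ (y , (λ { zero → y·u₀ ; (suc i) → y⊥ i }) , y·v≡1)
...   | true with span-or-separated k (u ∘ suc) (u zero +ᵥ v)
...     | inj₁ (c , c≗u₀+v) =
          inj₁ (true ∷ c , λ x → trans (cong (u zero x xor_) (c≗u₀+v x))
                                       (xor-cancelˡ (u zero x) (v x)))
...     | inj₂ (y′ , y′⊥ , y′·u₀+v≡1) = inj₂ (z , z⊥ , z·v≡1)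
  where
  a : Bool
  a = dot y′ (u zero)
  -- Correcting y′ by a multiple of y kills its pairing with u zero.
  z : Vec₂ n
  z = y′ +ᵥ a *ᵥ y
  dot-z : ∀ w → dot z w ≡ dot y′ w xor (a ∧ dot y w)
  dot-z w = trans (dot-+ᵥˡ y′ (a *ᵥ y) w) (cong (dot y′ w xor_) (dot-*ᵥˡ a y w))
  z⊥ : ∀ i → dot z (u i) ≡ false
  z⊥ zero = begin
    dot z (u zero)                 ≡⟨ dot-z (u zero) ⟩
    a xor (a ∧ dot y (u zero))     ≡⟨ cong (λ b → a xor (a ∧ b)) y·u₀ ⟩
    a xor (a ∧ true)               ≡⟨ cong (a xor_) (∧-identityʳ a) ⟩
    a xor a                        ≡⟨ xor-same a ⟩
    false                          ∎
  z⊥ (suc i) = begin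
    dot z (u (suc i))                         ≡⟨ dot-z (u (suc i)) ⟩
    dot y′ (u (suc i)) xor (a ∧ dot y (u (suc i))) ≡⟨ cong₂ (λ b c → b xor (a ∧ c)) (y′⊥ i) (y⊥ i) ⟩
    a ∧ false                                 ≡⟨ ∧-zeroʳ a ⟩
    false                                     ∎
  z·v≡1 : dot z v ≡ true
  z·v≡1 = begin
    dot z v                      ≡⟨ dot-z v ⟩
    dot y′ v xor (a ∧ dot y v)   ≡⟨ cong (λ b → dot y′ v xor (a ∧ b)) y·v≡1 ⟩
    dot y′ v xor (a ∧ true)      ≡⟨ cong (dot y′ v xor_) (∧-identityʳ a) ⟩
    dot y′ v xor a               ≡⟨ xor-comm (dot y′ v) a ⟩
    a xor dot y′ v               ≡⟨ dot-+ᵥʳ y′ (u zero) v ⟨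
    dot y′ (u zero +ᵥ v)         ≡⟨ y′·u₀+v≡1 ⟩
    true                         ∎

dual-family : ∀ {n k} {b : Fin k → Vec₂ n} → Independent b →
              ∀ j → ∃ λ y → ∀ i → dot (b i) y ≡ eqFin i j
dual-family {n} {b = b} b-ind j with span-or-separated n (b ᵀ) (λ i → eqFin i j)
... | inj₁ (y , y≗δ)       = y , λ i → trans (dot-comm (b i) y) (y≗δ i)
... | inj₂ (y , y⊥ , y·δ≡1) =
  contradiction (trans (sym y·δ≡1) (dot-zeroˡ (b-ind y y⊥))) λ ()

dual-coordinates : ∀ {n k} {b y : Fin k → Vec₂ n} → (∀ i j → dot (b i) (y j) ≡ eqFin i j) →
                   ∀ {v} → InSpan b v → v ≗ lincomb b (λ j → dot v (y j))
dual-coordinates {b = b} {y} b·y {v} (c , c≗v) x =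
  trans (sym (c≗v x)) (dot-congˡ coordinate)
  where
  coordinate : ∀ j → c j ≡ dot v (y j)
  coordinate j = begin
    c j                           ≡⟨ sumZ₂-δ j c ⟨
    dot (λ k → eqFin k j) c       ≡⟨ dot-congˡ (λ k → b·y k j) ⟨
    dot (b · y j) c               ≡⟨ dot-lincomb (y j) b c ⟨
    dot (y j) (lincomb b c)       ≡⟨ dot-congʳ c≗v ⟩
    dot (y j) v                   ≡⟨ dot-comm (y j) v ⟩
    dot v (y j)                   ∎

module UnitDiagonalSymmetric {n} (M : Fin n → Fin n → Bool)
  (M-sym : ∀ i j → M i j ≡ M j i) (M-diag : ∀ i → M i i ≡ true) where

  ᵀ·≗· : ∀ u → (M ᵀ · u) ≗ (M · u)
  ᵀ·≗· u r = sumZ₂-cong (λ c → cong (_∧ u c) (M-sym c r))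

  form-sym : ∀ u v → dot (M · u) v ≡ dot (M · v) u
  form-sym u v = begin
    dot (M · u) v    ≡⟨ dot-comm (M · u) v ⟩
    dot v (M · u)    ≡⟨ ·-adjoint v M u ⟩
    dot (M ᵀ · v) u  ≡⟨ dot-congˡ (ᵀ·≗· v) ⟩
    dot (M · v) u    ∎

  form-diag : ∀ x → dot (M · x) x ≡ sumZ₂ x
  form-diag x = begin
    dot (M · x) x
      ≡⟨ dot-comm (M · x) x ⟩
    sumZ₂ (λ r → x r ∧ sumZ₂ (λ c → M r c ∧ x c))
      ≡⟨ sumZ₂-cong (λ r → sumZ₂-∧ˡ (x r) (λ c → M r c ∧ x c)) ⟨
    sumZ₂ (λ r → sumZ₂ (λ c → x r ∧ (M r c ∧ x c)))
      ≡⟨ sumZ₂-symmetric _ term-sym ⟩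
    sumZ₂ (λ r → x r ∧ (M r r ∧ x r))
      ≡⟨ sumZ₂-cong diagonal-term ⟩
    sumZ₂ x ∎
    where
    term-sym : ∀ r c → x r ∧ (M r c ∧ x c) ≡ x c ∧ (M c r ∧ x r)
    term-sym r c = trans (x∙yz≈z∙yx (x r) (M r c) (x c)) (cong (λ m → x c ∧ (m ∧ x r)) (M-sym r c))
    diagonal-term : ∀ r → x r ∧ (M r r ∧ x r) ≡ x r
    diagonal-term r = trans (cong (λ m → x r ∧ (m ∧ x r)) (M-diag r)) (∧-idem (x r))

  kernel-even : ∀ {x} → Kernel M x → sumZ₂ x ≡ false
  kernel-even {x} Mx≗0 = trans (sym (form-diag x)) (dot-zeroˡ Mx≗0)

  ones∈ColSpace : ColSpace M ones
  ones∈ColSpace with span-or-separated n (M ᵀ) ones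
  ... | inj₁ (c , c≗1)         = c , λ r → trans (sym (lincomb-ᵀ (M ᵀ) c r)) (c≗1 r)
  ... | inj₂ (y , y⊥ , y·1≡1) =
    contradiction (trans (sym y·1≡1) (trans (dot-comm y ones) (kernel-even My≗0))) λ ()
    where
    My≗0 : Kernel M y
    My≗0 r = trans (sym (ᵀ·≗· y r)) (trans (dot-comm ((M ᵀ) r) y) (y⊥ r))

  -- For b spanning the column space, with preimages x′ and a dual family y, take the
  -- entrywise product of the Gram matrices of x′ and y for (u , v) ↦ Mu · v: its rows
  -- sum to bⱼ · yⱼ = 1, and its trace is Σ x whenever Mx = 1.
  module ColumnBasis {ρ} (b x′ y : Fin ρ → Vec₂ n) (Mx′≗b : ∀ k → (M · x′ k) ≗ b k)
    (b·y : ∀ i j → dot (b i) (y j) ≡ eqFin i j) (b-span : ∀ v → ColSpace M v → InSpan b v)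
    where

    b·≡Mx′· : ∀ k v → dot (b k) v ≡ dot (M · x′ k) v
    b·≡Mx′· k v = dot-congˡ (λ r → sym (Mx′≗b k r))

    expand : ∀ {v} → ColSpace M v → v ≗ lincomb b (λ j → dot v (y j))
    expand v∈ = dual-coordinates b·y (b-span _ v∈)

    gram-product : Fin ρ → Fin ρ → Bool
    gram-product j k = dot (b k) (x′ j) ∧ dot (M · y j) (y k)

    gram-product-sym : ∀ j k → gram-product j k ≡ gram-product k j
    gram-product-sym j k = cong₂ _∧_
      (trans (b·≡Mx′· k (x′ j)) (trans (form-sym (x′ k) (x′ j)) (sym (b·≡Mx′· j (x′ k)))))
      (form-sym (y j) (y k))

    row-sum : ∀ j → sumZ₂ (gram-product j) ≡ dot (b j) (y j)
    row-sum j = begin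
      sumZ₂ (gram-product j)                         ≡⟨ dot-lincomb (x′ j) b _ ⟨
      dot (x′ j) (lincomb b (λ k → dot (M · y j) (y k)))
                                                     ≡⟨ dot-congʳ (expand (y j , λ _ → refl)) ⟨
      dot (x′ j) (M · y j)                           ≡⟨ dot-comm (x′ j) (M · y j) ⟩
      dot (M · y j) (x′ j)                           ≡⟨ form-sym (y j) (x′ j) ⟩
      dot (M · x′ j) (y j)                           ≡⟨ b·≡Mx′· j (y j) ⟨
      dot (b j) (y j)                                ∎

    rank-trace : sumZ₂ (λ k → gram-product k k) ≡ odd ρ
    rank-trace = begin
      sumZ₂ (λ k → gram-product k k)
        ≡⟨ sumZ₂-symmetric gram-product gram-product-sym ⟨
      sumZ₂ (λ j → sumZ₂ (gram-product j))
        ≡⟨ sumZ₂-cong row-sum ⟩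
      sumZ₂ (λ j → dot (b j) (y j))
        ≡⟨ sumZ₂-cong (λ j → trans (b·y j j) (eqFin-refl j)) ⟩
      sumZ₂ {ρ} (λ _ → true)
        ≡⟨ sumZ₂-true ρ ⟩
      odd ρ ∎

    weight-trace : ∀ {x} → (M · x) ≗ ones → sumZ₂ x ≡ sumZ₂ (λ k → gram-product k k)
    weight-trace {x} Mx≗1 = begin
      sumZ₂ x
        ≡⟨ dot-comm ones x ⟩
      dot x ones
        ≡⟨ dot-congʳ (expand (x , Mx≗1)) ⟩
      dot x (lincomb b (λ k → dot ones (y k)))
        ≡⟨ dot-lincomb x b _ ⟩
      sumZ₂ (λ k → dot (b k) x ∧ sumZ₂ (y k))
        ≡⟨ sumZ₂-cong (λ k → cong₂ _∧_ (b·x k) (sym (form-diag (y k)))) ⟩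
      sumZ₂ (λ k → gram-product k k) ∎
      where
      b·x : ∀ k → dot (b k) x ≡ dot (b k) (x′ k)
      b·x k = begin
        dot (b k) x                ≡⟨ b·≡Mx′· k x ⟩
        dot (M · x′ k) x           ≡⟨ form-sym (x′ k) x ⟩
        dot (M · x) (x′ k)         ≡⟨ dot-congˡ Mx≗1 ⟩
        sumZ₂ (x′ k)               ≡⟨ form-diag (x′ k) ⟨
        dot (M · x′ k) (x′ k)      ≡⟨ b·≡Mx′· k (x′ k) ⟨
        dot (b k) (x′ k)           ∎

  odd-rank : ∀ {ρ} → HasDim (ColSpace M) ρ → ∀ {x} → (M · x) ≗ ones → sumZ₂ x ≡ odd ρ
  odd-rank (b , b∈ , b-ind , b-span) Mx≗1 = trans (weight-trace Mx≗1) rank-trace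
    where
    open ColumnBasis b (proj₁ ∘ b∈) (λ j → proj₁ (dual-family b-ind j)) (proj₂ ∘ b∈)
                     (λ i j → proj₂ (dual-family b-ind j) i) b-span

  preimage-weight : ∀ {ρ} → HasDim (ColSpace M) ρ → ∀ {x} s → (M · x) ≗ (λ _ → s) →
                    sumZ₂ x ≡ s ∧ odd ρ
  preimage-weight _    false Mx≗0 = kernel-even Mx≗0
  preimage-weight rank true  Mx≗1 = odd-rank rank Mx≗1

HasDim-≐ : ∀ {n} {S T : Vec₂ n → Set} {d} → S ≐ T → HasDim S d → HasDim T d
HasDim-≐ (S⊆T , T⊆S) (b , b∈S , b-ind , b-span) =
  b , (λ i → S⊆T (b∈S i)) , b-ind , λ v v∈T → b-span v (T⊆S v∈T)

_×ᵥ_ : ∀ {m n} → (Vec₂ m → Set) → (Vec₂ n → Set) → Vec₂ (m + n) → Set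
_×ᵥ_ {m} {n} S T v = S (v ∘ (_↑ˡ n)) × T (v ∘ (m ↑ʳ_))

HasDim-×ᵥ : ∀ {m n d₁ d₂} {S : Vec₂ m → Set} {T : Vec₂ n → Set} →
            S Respects _≗_ → T Respects _≗_ → S zeroV → T zeroV →
            HasDim S d₁ → HasDim T d₂ → HasDim (S ×ᵥ T) (d₁ + d₂)
HasDim-×ᵥ {m} {n} {d₁} {d₂} {S} {T} S-resp T-resp 0∈S 0∈T
          (b₁ , b₁∈S , b₁-ind , b₁-span) (b₂ , b₂∈T , b₂-ind , b₂-span) =
  b , b∈S×T , b-ind , b-span
  where
  b₁⁺ : Fin d₁ → Vec₂ (m + n)
  b₁⁺ i = b₁ i ++ zeroV
  b₂⁺ : Fin d₂ → Vec₂ (m + n)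
  b₂⁺ j = zeroV ++ b₂ j
  b : Fin (d₁ + d₂) → Vec₂ (m + n)
  b = b₁⁺ ++ b₂⁺

  b-↑ˡ-↑ˡ : ∀ i r → b (i ↑ˡ d₂) (r ↑ˡ n) ≡ b₁ i r
  b-↑ˡ-↑ˡ i r = trans (cong-app (lookup-++ˡ b₁⁺ b₂⁺ i) (r ↑ˡ n)) (lookup-++ˡ (b₁ i) (zeroV {n}) r)
  b-↑ˡ-↑ʳ : ∀ i r → b (i ↑ˡ d₂) (m ↑ʳ r) ≡ false
  b-↑ˡ-↑ʳ i r = trans (cong-app (lookup-++ˡ b₁⁺ b₂⁺ i) (m ↑ʳ r)) (lookup-++ʳ (b₁ i) (zeroV {n}) r)
  b-↑ʳ-↑ˡ : ∀ j r → b (d₁ ↑ʳ j) (r ↑ˡ n) ≡ false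
  b-↑ʳ-↑ˡ j r = trans (cong-app (lookup-++ʳ b₁⁺ b₂⁺ j) (r ↑ˡ n)) (lookup-++ˡ (zeroV {m}) (b₂ j) r)
  b-↑ʳ-↑ʳ : ∀ j r → b (d₁ ↑ʳ j) (m ↑ʳ r) ≡ b₂ j r
  b-↑ʳ-↑ʳ j r = trans (cong-app (lookup-++ʳ b₁⁺ b₂⁺ j) (m ↑ʳ r)) (lookup-++ʳ (zeroV {m}) (b₂ j) r)

  lincomb-↑ˡ : ∀ c r → lincomb b c (r ↑ˡ n) ≡ lincomb b₁ (c ∘ (_↑ˡ d₂)) r
  lincomb-↑ˡ c r = begin
    lincomb b c (r ↑ˡ n)
      ≡⟨ sumZ₂-↑ d₁ (λ t → c t ∧ b t (r ↑ˡ n)) ⟩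
    dot (c ∘ (_↑ˡ d₂)) (λ i → b (i ↑ˡ d₂) (r ↑ˡ n)) xor
    dot (c ∘ (d₁ ↑ʳ_)) (λ j → b (d₁ ↑ʳ j) (r ↑ˡ n))
      ≡⟨ cong₂ _xor_ (dot-congʳ (λ i → b-↑ˡ-↑ˡ i r)) (dot-zeroʳ (λ j → b-↑ʳ-↑ˡ j r)) ⟩
    lincomb b₁ (c ∘ (_↑ˡ d₂)) r xor false
      ≡⟨ xor-identityʳ _ ⟩
    lincomb b₁ (c ∘ (_↑ˡ d₂)) r ∎

  lincomb-↑ʳ : ∀ c r → lincomb b c (m ↑ʳ r) ≡ lincomb b₂ (c ∘ (d₁ ↑ʳ_)) r
  lincomb-↑ʳ c r = trans (sumZ₂-↑ d₁ (λ t → c t ∧ b t (m ↑ʳ r)))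
    (cong₂ _xor_ (dot-zeroʳ (λ i → b-↑ˡ-↑ʳ i r)) (dot-congʳ (λ j → b-↑ʳ-↑ʳ j r)))

  b∈S×T : ∀ t → (S ×ᵥ T) (b t)
  b∈S×T = ↑-elim d₁
    (λ i → S-resp (λ r → sym (b-↑ˡ-↑ˡ i r)) (b₁∈S i) , T-resp (λ r → sym (b-↑ˡ-↑ʳ i r)) 0∈T)
    (λ j → S-resp (λ r → sym (b-↑ʳ-↑ˡ j r)) 0∈S , T-resp (λ r → sym (b-↑ʳ-↑ʳ j r)) (b₂∈T j))

  b-ind : Independent b
  b-ind c bc≗0 = ↑-elim d₁
    (b₁-ind (c ∘ (_↑ˡ d₂)) (λ r → trans (sym (lincomb-↑ˡ c r)) (bc≗0 (r ↑ˡ n))))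
    (b₂-ind (c ∘ (d₁ ↑ʳ_)) (λ r → trans (sym (lincomb-↑ʳ c r)) (bc≗0 (m ↑ʳ r))))

  b-span : ∀ v → (S ×ᵥ T) v → InSpan b v
  b-span v (v₁∈S , v₂∈T) =
    let c₁ , b₁c₁≗v₁ = b₁-span _ v₁∈S
        c₂ , b₂c₂≗v₂ = b₂-span _ v₂∈T
    in  c₁ ++ c₂ , ↑-elim m
          (λ r → trans (lincomb-↑ˡ (c₁ ++ c₂) r) (trans (dot-congˡ (lookup-++ˡ c₁ c₂)) (b₁c₁≗v₁ r)))
          (λ r → trans (lincomb-↑ʳ (c₁ ++ c₂) r) (trans (dot-congˡ (lookup-++ʳ c₁ c₂)) (b₂c₂≗v₂ r)))

HasDim-extend : ∀ {n} {S T : Vec₂ n → Set} {d} (a v₀ : Vec₂ n) →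
                HasDim T d → T ⊆ S → S v₀ →
                (∀ {v} → T v → dot a v ≡ false) → dot a v₀ ≡ true →
                (∀ {v} → S v → T v ⊎ T (v₀ +ᵥ v)) → HasDim S (suc d)
HasDim-extend {S = S} a v₀ (b , b∈T , b-ind , b-span) T⊆S v₀∈S a⊥T a·v₀≡1 S⊆T∪v₀+T =
  v₀ ∷ b , b′∈S , b′-ind , b′-span
  where
  b′∈S : ∀ i → S ((v₀ ∷ b) i)
  b′∈S zero    = v₀∈S
  b′∈S (suc i) = T⊆S (b∈T i)

  c₀≡0 : ∀ c → lincomb (v₀ ∷ b) c ≗ zeroV → c zero ≡ false
  c₀≡0 c b′c≗0 = begin
    c zero
      ≡⟨ xor-identityʳ (c zero) ⟨
    c zero xor false
      ≡⟨ cong₂ (λ p q → (p ∧ c zero) xor q) (trans (dot-comm v₀ a) a·v₀≡1)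
               (dot-zeroˡ (λ i → trans (dot-comm (b i) a) (a⊥T (b∈T i)))) ⟨
    (dot v₀ a ∧ c zero) xor dot (λ i → dot (b i) a) (c ∘ suc)
      ≡⟨ dot-lincomb a (v₀ ∷ b) c ⟨
    dot a (lincomb (v₀ ∷ b) c)
      ≡⟨ dot-zeroʳ b′c≗0 ⟩
    false ∎

  b′-ind : Independent (v₀ ∷ b)
  b′-ind c b′c≗0 zero    = c₀≡0 c b′c≗0
  b′-ind c b′c≗0 (suc i) =
    b-ind (c ∘ suc) (λ x → trans (cong (λ c₀ → (c₀ ∧ v₀ x) xor lincomb b (c ∘ suc) x)
                                        (sym (c₀≡0 c b′c≗0))) (b′c≗0 x)) i

  b′-span : ∀ v → S v → InSpan (v₀ ∷ b) v
  b′-span v v∈S with S⊆T∪v₀+T v∈S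
  ... | inj₁ v∈T      = let c , bc≗v = b-span v v∈T in false ∷ c , bc≗v
  ... | inj₂ v₀+v∈T =
    let c , bc≗v₀+v = b-span (v₀ +ᵥ v) v₀+v∈T
    in  true ∷ c , λ x → trans (cong (v₀ x xor_) (bc≗v₀+v x)) (xor-cancelˡ (v₀ x) (v x))

N-sym : (G : Graph) → ∀ v w → N G v w ≡ N G w v
N-sym G v w = cong₂ _∨_ (Graph.sym G v w) (eqFin-sym v w)

N-diag : (G : Graph) → ∀ v → N G v v ≡ true
N-diag G v = cong₂ _∨_ (irrefl G v) (eqFin-refl v)

module Join (G₁ G₂ : Graph) {ρ₁ ρ₂ ν₁ ν₂ : ℕ}
  (rank₁ : Rank G₁ ρ₁) (rank₂ : Rank G₂ ρ₂)
  (nullity₁ : Nullity G₁ ν₁) (nullity₂ : Nullity G₂ ν₂) where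

  private
    n₁ n₂ : ℕ
    n₁ = order G₁
    n₂ = order G₂
    J : Graph
    J = G₁ ⊕ G₂
    module S₁ = UnitDiagonalSymmetric (N G₁) (N-sym G₁) (N-diag G₁)
    module S₂ = UnitDiagonalSymmetric (N G₂) (N-sym G₂) (N-diag G₂)

  left : Vec₂ (n₁ + n₂) → Vec₂ n₁
  left v = v ∘ (_↑ˡ n₂)

  right : Vec₂ (n₁ + n₂) → Vec₂ n₂
  right v = v ∘ (n₁ ↑ʳ_)

  N-↑ˡ-↑ˡ : ∀ i j → N J (i ↑ˡ n₂) (j ↑ˡ n₂) ≡ N G₁ i j
  N-↑ˡ-↑ˡ i j rewrite splitAt-↑ˡ n₁ i n₂ | splitAt-↑ˡ n₁ j n₂ =
    cong (adj G₁ i j ∨_) (eqFin-↑ˡ n₂ i j)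

  N-↑ʳ-↑ʳ : ∀ i j → N J (n₁ ↑ʳ i) (n₁ ↑ʳ j) ≡ N G₂ i j
  N-↑ʳ-↑ʳ i j rewrite splitAt-↑ʳ n₁ n₂ i | splitAt-↑ʳ n₁ n₂ j =
    cong (adj G₂ i j ∨_) (eqFin-↑ʳ n₁ i j)

  N-↑ˡ-↑ʳ : ∀ i j → N J (i ↑ˡ n₂) (n₁ ↑ʳ j) ≡ true
  N-↑ˡ-↑ʳ i j rewrite splitAt-↑ˡ n₁ i n₂ | splitAt-↑ʳ n₁ n₂ j = refl

  N-↑ʳ-↑ˡ : ∀ i j → N J (n₁ ↑ʳ i) (j ↑ˡ n₂) ≡ true
  N-↑ʳ-↑ˡ i j rewrite splitAt-↑ʳ n₁ n₂ i | splitAt-↑ˡ n₁ j n₂ = refl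

  ·-↑ˡ : ∀ v i → (N J · v) (i ↑ˡ n₂) ≡ (N G₁ · left v) i xor sumZ₂ (right v)
  ·-↑ˡ v i = trans (sumZ₂-↑ n₁ (λ c → N J (i ↑ˡ n₂) c ∧ v c))
    (cong₂ _xor_ (dot-congˡ (N-↑ˡ-↑ˡ i)) (dot-congˡ (N-↑ˡ-↑ʳ i)))

  ·-↑ʳ : ∀ v j → (N J · v) (n₁ ↑ʳ j) ≡ sumZ₂ (left v) xor (N G₂ · right v) j
  ·-↑ʳ v j = trans (sumZ₂-↑ n₁ (λ c → N J (n₁ ↑ʳ j) c ∧ v c))
    (cong₂ _xor_ (dot-congˡ (N-↑ʳ-↑ˡ j)) (dot-congˡ (N-↑ʳ-↑ʳ j)))

  kernel⁺ : ∀ {v} → Kernel (N J) v →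
            (N G₁ · left v) ≗ (λ _ → sumZ₂ (right v)) × (N G₂ · right v) ≗ (λ _ → sumZ₂ (left v))
  kernel⁺ {v} v∈K =
    (λ i → xor≡false⇒≡ (trans (sym (·-↑ˡ v i)) (v∈K (i ↑ˡ n₂)))) ,
    (λ j → sym (xor≡false⇒≡ (trans (sym (·-↑ʳ v j)) (v∈K (n₁ ↑ʳ j)))))

  kernel⁻ : ∀ {v} → (N G₁ · left v) ≗ (λ _ → sumZ₂ (right v)) →
            (N G₂ · right v) ≗ (λ _ → sumZ₂ (left v)) → Kernel (N J) v
  kernel⁻ {v} N₁x≗Σy N₂y≗Σx = ↑-elim n₁
    (λ i → trans (·-↑ˡ v i)
                 (trans (cong (_xor sumZ₂ (right v)) (N₁x≗Σy i)) (xor-same (sumZ₂ (right v)))))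
    (λ j → trans (·-↑ʳ v j)
                 (trans (cong (sumZ₂ (left v) xor_) (N₂y≗Σx j)) (xor-same (sumZ₂ (left v)))))

  T : Vec₂ (n₁ + n₂) → Set
  T = Kernel (N G₁) ×ᵥ Kernel (N G₂)

  T⊆K : T ⊆ Kernel (N J)
  T⊆K (x∈K₁ , y∈K₂) = kernel⁻ (λ i → trans (x∈K₁ i) (sym (S₂.kernel-even y∈K₂)))
                              (λ j → trans (y∈K₂ j) (sym (S₁.kernel-even x∈K₁)))

  kernel-cases : ∀ {v} → Kernel (N J) v →
                 T v ⊎ (odd ρ₁ ≡ true × odd ρ₂ ≡ true ×
                        (N G₁ · left v) ≗ ones × (N G₂ · right v) ≗ ones)
  kernel-cases v∈K with kernel⁺ v∈K
  ... | N₁x≗Σy , N₂y≗Σx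
      with ∧-mutual-cases (S₁.preimage-weight rank₁ _ N₁x≗Σy) (S₂.preimage-weight rank₂ _ N₂y≗Σx)
  ... | inj₁ (Σx≡0 , Σy≡0) =
        inj₁ ((λ i → trans (N₁x≗Σy i) Σy≡0) , (λ j → trans (N₂y≗Σx j) Σx≡0))
  ... | inj₂ (Σx≡1 , Σy≡1 , odd₁ , odd₂) =
        inj₂ (odd₁ , odd₂ , (λ i → trans (N₁x≗Σy i) Σy≡1) , (λ j → trans (N₂y≗Σx j) Σx≡1))

  dim-T : HasDim T (ν₁ + ν₂)
  dim-T = HasDim-×ᵥ Kernel-resp Kernel-resp Kernel-zero Kernel-zero nullity₁ nullity₂

  nullity-unless-both-odd : odd ρ₁ ∧ odd ρ₂ ≡ false → Nullity J (ν₁ + ν₂)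
  nullity-unless-both-odd not-both-odd = HasDim-≐ (T⊆K , K⊆T) dim-T
    where
    K⊆T : Kernel (N J) ⊆ T
    K⊆T v∈K with kernel-cases v∈K
    ... | inj₁ v∈T                = v∈T
    ... | inj₂ (odd₁ , odd₂ , _) =
      contradiction (trans (sym (cong₂ _∧_ odd₁ odd₂)) not-both-odd) λ ()

  z₁ : Vec₂ n₁
  z₁ = proj₁ S₁.ones∈ColSpace

  z₂ : Vec₂ n₂
  z₂ = proj₁ S₂.ones∈ColSpace

  v₀ : Vec₂ (n₁ + n₂)
  v₀ = z₁ ++ z₂

  N·left-v₀ : (N G₁ · left v₀) ≗ ones
  N·left-v₀ i = trans (·-cong (N G₁) (lookup-++ˡ z₁ z₂) i) (proj₂ S₁.ones∈ColSpace i)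

  N·right-v₀ : (N G₂ · right v₀) ≗ ones
  N·right-v₀ j = trans (·-cong (N G₂) (lookup-++ʳ z₁ z₂) j) (proj₂ S₂.ones∈ColSpace j)

  Σleft-v₀ : sumZ₂ (left v₀) ≡ odd ρ₁
  Σleft-v₀ = S₁.odd-rank rank₁ N·left-v₀

  Σright-v₀ : sumZ₂ (right v₀) ≡ odd ρ₂
  Σright-v₀ = S₂.odd-rank rank₂ N·right-v₀

  v₀+-∈T : ∀ {v} → (N G₁ · left v) ≗ ones → (N G₂ · right v) ≗ ones → T (v₀ +ᵥ v)
  v₀+-∈T {v} N·left≗1 N·right≗1 =
    (λ i → trans (·-+ᵥ (N G₁) (left v₀) (left v) i) (cong₂ _xor_ (N·left-v₀ i) (N·left≗1 i))) ,
    (λ j → trans (·-+ᵥ (N G₂) (right v₀) (right v) j) (cong₂ _xor_ (N·right-v₀ j) (N·right≗1 j)))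

  left-indicator : Vec₂ (n₁ + n₂)
  left-indicator = ones {n₁} ++ zeroV

  dot-left-indicator : ∀ v → dot left-indicator v ≡ sumZ₂ (left v)
  dot-left-indicator v = begin
    dot left-indicator v
      ≡⟨ dot-comm left-indicator v ⟩
    dot v left-indicator
      ≡⟨ dot-++ʳ {n₁} v ones zeroV ⟩
    dot (left v) ones xor dot (right v) (zeroV {n₂})
      ≡⟨ cong₂ _xor_ (dot-comm (left v) ones) (dot-zeroʳ {u = right v} (λ _ → refl)) ⟩
    sumZ₂ (left v) xor false
      ≡⟨ xor-identityʳ _ ⟩
    sumZ₂ (left v) ∎

  nullity-both-odd : odd ρ₁ ≡ true → odd ρ₂ ≡ true → Nullity J (suc (ν₁ + ν₂))
  nullity-both-odd odd₁ odd₂ =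
    HasDim-extend left-indicator v₀ dim-T T⊆K v₀∈K
      (λ {v} v∈T → trans (dot-left-indicator v) (S₁.kernel-even (proj₁ v∈T)))
      (trans (dot-left-indicator v₀) (trans Σleft-v₀ odd₁))
      K⊆T∪v₀+T
    where
    v₀∈K : Kernel (N J) v₀
    v₀∈K = kernel⁻ (λ i → trans (N·left-v₀ i) (sym (trans Σright-v₀ odd₂)))
                   (λ j → trans (N·right-v₀ j) (sym (trans Σleft-v₀ odd₁)))
    K⊆T∪v₀+T : ∀ {v} → Kernel (N J) v → T v ⊎ T (v₀ +ᵥ v)
    K⊆T∪v₀+T {v} v∈K with kernel-cases v∈K
    ... | inj₁ v∈T                           = inj₁ v∈T
    ... | inj₂ (_ , _ , N·left≗1 , N·right≗1) = inj₂ (v₀+-∈T {v} N·left≗1 N·right≗1)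

  nullity : Nullity J (ν₁ + ν₂ + pr (ρ₁ * ρ₂))
  nullity rewrite pr-* ρ₁ ρ₂ with odd ρ₁ in odd₁ | odd ρ₂ in odd₂
  ... | true  | true  = subst (Nullity J) (+-comm 1 (ν₁ + ν₂)) (nullity-both-odd odd₁ odd₂)
  ... | true  | false = subst (Nullity J) (sym (+-identityʳ (ν₁ + ν₂)))
                             (nullity-unless-both-odd (cong₂ _∧_ odd₁ odd₂))
  ... | false | _     = subst (Nullity J) (sym (+-identityʳ (ν₁ + ν₂)))
                             (nullity-unless-both-odd (cong (_∧ odd ρ₂) odd₁))

proposition3p6 : (G₁ G₂ : Graph) (ρ₁ ρ₂ ν₁ ν₂ ν : ℕ) →
    Rank G₁ ρ₁ → Rank G₂ ρ₂ → Nullity G₁ ν₁ → Nullity G₂ ν₂ →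
    Nullity (G₁ ⊕ G₂) ν →
    ν ≡ ν₁ + ν₂ + pr (ρ₁ * ρ₂)
proposition3p6 G₁ G₂ ρ₁ ρ₂ ν₁ ν₂ ν rank₁ rank₂ nullity₁ nullity₂ nullity =
  HasDim-unique nullity (Join.nullity G₁ G₂ rank₁ rank₂ nullity₁ nullity₂)
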